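{- Let $\Gamma_1=({\mathcal V}_1,{\mathcal D}_1)$ and $\Gamma_2=({\mathcal V}_2,{\mathcal D}_2)$ be digraphs without sources and sinks, let $\Gamma=\mathrm{SBP}(\Gamma_1,\Gamma_2)$, and let $G_j\le{\rm Aut}(\Gamma_j)$ for $j\in\{1,2\}$. Then setting $(a,x,i)^{(g_1,g_2)}=(a^{g_1},x^{g_2},i)$ for every vertex $(a,x,i)$ of $\Gamma$ and every $(g_1,g_2)\in G_1\times G_2$ defines a faithful action of $G_1\times G_2$ on $\Gamma$ as a group of symmetries. Moreover: (i) if $G_1$ and $G_2$ act transitively on the vertices of $\Gamma_1$ and $\Gamma_2$ respectively, then $G_1\times G_2$ has two orbits on the vertices of $\Gamma$, namely the set of white vertices and the set of black vertices; (ii) if $G_1$ and $G_2$ act transitively on the darts of $\Gamma_1$ and $\Gamma_2$ respectively, then $G_1\times G_2$ has two orbits on the darts of $\Gamma$, namely the set of horizontal darts and the set of vertical darts. Furthermore, if $\Gamma_1$ and $\Gamma_2$ possess reversals $\sigma_1$ and $\sigma_2$ respectively, then the permutation $\sigma$ of the vertex set of $\Gamma$ defined by $(a,x,i)^\sigma=(a^{\sigma_1},x^{\sigma_2},1-i)$ is a reversal of $\Gamma$.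
   Context: A digraph is a pair $({\mathcal V},{\mathcal D})$ with ${\mathcal V}$ a finite non-empty set and ${\mathcal D}$ a set of ordered pairs of distinct vertices (darts). A source (sink) is a vertex with in-valence (out-valence) $0$. A symmetry is a vertex permutation preserving the dart set. The reverse of $\Gamma=({\mathcal V},{\mathcal D})$ is $\Gamma^{ -1}=({\mathcal V},{\mathcal D}^{ -1})$ with ${\mathcal D}^{ -1}=\{(v,u):(u,v)\in{\mathcal D}\}$; a reversal of $\Gamma$ is an isomorphism from $\Gamma$ to $\Gamma^{ -1}$. $\mathrm{SBP}(\Gamma_1,\Gamma_2)$ is the digraph with vertex set ${\mathcal V}_1\times{\mathcal V}_2\times\mathbb Z_2$ whose darts are all $((a,x,0),(b,x,1))$ with $(a,b)\in{\mathcal D}_1$, $x\in{\mathcal V}_2$ (horizontal darts) and all $((a,x,1),(a,y,0))$ with $a\in{\mathcal V}_1$, $(x,y)\in{\mathcal D}_2$ (vertical darts). Vertices with third coordinate $0$ are white, those with third coordinate $1$ are black. -}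

module Defs where

open import Data.Bool using (Bool; true; false; not)
open import Data.Bool.Properties using (not-involutive)
open import Data.Fin using (Fin)
open import Data.Nat using (ℕ)
open import Data.Product using (Σ; ∃; _×_; _,_; proj₁; proj₂)
open import Data.Sum using (_⊎_)
open import Data.Empty using (⊥)
open import Relation.Nullary using (¬_)
open import Relation.Binary.PropositionalEquality using (_≡_; refl)
open import Function using (_↔_; Inverse)
open import Function.Bundles using (mk↔ₛ′)
open import Function.Construct.Identity using (↔-id)
open import Function.Construct.Symmetry using (↔-sym)
open import Function.Construct.Composition using (_↔-∘_)
open import Data.Product.Function.NonDependent.Propositional using (_×-↔_)

-- A digraph: a vertex type together with a dart relation.
-- The standing conditions (finite, non-empty vertex set; darts join
-- distinct vertices) are the predicate IsDigraph below.
record Digraph : Set₁ where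
  constructor digraph
  field
    V : Set
    D : V → V → Set
open Digraph public

IsDigraph : Digraph → Set
IsDigraph Γ =
  (Σ ℕ λ n → Fin n ↔ V Γ) × V Γ × (∀ u → ¬ D Γ u u)

NoSources : Digraph → Set
NoSources Γ = ∀ v → ∃ λ u → D Γ u v

NoSinks : Digraph → Set
NoSinks Γ = ∀ v → ∃ λ u → D Γ v u

Perm : Set → Set
Perm A = A ↔ A

IsIso : (Γ Δ : Digraph) → V Γ ↔ V Δ → Set
IsIso Γ Δ σ = ∀ u v →
  (D Γ u v → D Δ (Inverse.to σ u) (Inverse.to σ v)) ×
  (D Δ (Inverse.to σ u) (Inverse.to σ v) → D Γ u v)

IsSymmetry : (Γ : Digraph) → Perm (V Γ) → Set
IsSymmetry Γ σ = IsIso Γ Γ σ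

Rev : Digraph → Digraph
Rev Γ = digraph (V Γ) (λ u v → D Γ v u)

IsReversal : (Γ : Digraph) → Perm (V Γ) → Set
IsReversal Γ σ = IsIso Γ (Rev Γ) σ

record Subgroup≤Aut (Γ : Digraph) : Set₁ where
  field
    _∈G : Perm (V Γ) → Set
    sym-G : ∀ g → g ∈G → IsSymmetry Γ g
    id-G  : ↔-id (V Γ) ∈G
    ∘-G   : ∀ g h → g ∈G → h ∈G → (g ↔-∘ h) ∈G
    inv-G : ∀ g → g ∈G → ↔-sym g ∈G
open Subgroup≤Aut public

VertexTransitive : (Γ : Digraph) → Subgroup≤Aut Γ → Set
VertexTransitive Γ G = ∀ a b → ∃ λ g → _∈G G g × Inverse.to g a ≡ b

DartTransitive : (Γ : Digraph) → Subgroup≤Aut Γ → Set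
DartTransitive Γ G = ∀ a b c d → D Γ a b → D Γ c d →
  ∃ λ g → _∈G G g × Inverse.to g a ≡ c × Inverse.to g b ≡ d

-- Z₂ is represented by Bool: false = 0 (white), true = 1 (black);
-- 1 - i is not i.
module _ (Γ₁ Γ₂ : Digraph) where
  SV : Set
  SV = V Γ₁ × V Γ₂ × Bool

  data SD : SV → SV → Set where
    horiz : ∀ {a b} x → D Γ₁ a b → SD (a , x , false) (b , x , true)
    vert  : ∀ a {x y} → D Γ₂ x y → SD (a , x , true) (a , y , false)

  SBP : Digraph
  SBP = digraph SV SD

  White Black : SV → Set
  White v = proj₂ (proj₂ v) ≡ false
  Black v = proj₂ (proj₂ v) ≡ true

  Horizontal : SV → SV → Set
  Horizontal u v = Σ (V Γ₁) λ a → Σ (V Γ₁) λ b → Σ (V Γ₂) λ x →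
    D Γ₁ a b × u ≡ (a , x , false) × v ≡ (b , x , true)

  Vertical : SV → SV → Set
  Vertical u v = Σ (V Γ₁) λ a → Σ (V Γ₂) λ x → Σ (V Γ₂) λ y →
    D Γ₂ x y × u ≡ (a , x , true) × v ≡ (a , y , false)

  actPerm : Perm (V Γ₁) → Perm (V Γ₂) → Perm SV
  actPerm g₁ g₂ = g₁ ×-↔ (g₂ ×-↔ ↔-id Bool)

  act : Perm (V Γ₁) → Perm (V Γ₂) → SV → SV
  act g₁ g₂ = Inverse.to (actPerm g₁ g₂)

  notPerm : Perm Bool
  notPerm = mk↔ₛ′ not not not-involutive not-involutive

  revPerm : Perm (V Γ₁) → Perm (V Γ₂) → Perm SV
  revPerm σ₁ σ₂ = σ₁ ×-↔ (σ₂ ×-↔ notPerm)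

{-# OPTIONS --safe #-}
module Submission where

-- Every ingredient acts coordinatewise, and the colour of a vertex decides
-- the kind of dart leaving it, so symmetry, the action laws and the orbit
-- descriptions reduce to the corresponding facts for Γ₁ and Γ₂.  The
-- reversal factors as σ₁ × σ₂ × id, an isomorphism SBP(Γ₁,Γ₂) ≅ SBP(Γ₁⁻¹,Γ₂⁻¹),
-- followed by swapping the colours, an isomorphism SBP(Γ₁⁻¹,Γ₂⁻¹) ≅ SBP(Γ₁,Γ₂)⁻¹.

open import Defs
open import Data.Bool using (Bool; true; false)
open import Data.Empty using (⊥-elim)
open import Data.Product using (∃; _×_; _,_; proj₁; proj₂)
open import Data.Product.Function.NonDependent.Propositional using (_×-↔_)
open import Data.Sum using (_⊎_; inj₁; inj₂)
open import Function using (Inverse; _↔_; Injection)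
open import Function.Construct.Identity using (↔-id)
open import Function.Construct.Composition using (_↔-∘_)
open import Function.Properties.Inverse using (↔⇒↣)
open import Relation.Binary.PropositionalEquality using (_≡_; refl; cong)
open import Relation.Nullary using (¬_)

private variable
  Γ Δ Θ : Digraph

to-injective : ∀ {A B : Set} (σ : A ↔ B) {x y} → Inverse.to σ x ≡ Inverse.to σ y → x ≡ y
to-injective σ = Injection.injective (↔⇒↣ σ)

IsIso-∘ : {σ : V Γ ↔ V Δ} {τ : V Δ ↔ V Θ} →
  IsIso Γ Δ σ → IsIso Δ Θ τ → IsIso Γ Θ (τ ↔-∘ σ)
IsIso-∘ σ-iso τ-iso u v =
  (λ d → proj₁ (τ-iso _ _) (proj₁ (σ-iso u v) d)) ,
  (λ d → proj₂ (σ-iso u v) (proj₂ (τ-iso _ _) d))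

DartTransitive⇒VertexTransitive : (G : Subgroup≤Aut Γ) →
  NoSinks Γ → DartTransitive Γ G → VertexTransitive Γ G
DartTransitive⇒VertexTransitive G no-sinks dt a b
  with a′ , d ← no-sinks a | b′ , e ← no-sinks b
  with g , g∈G , ga≡b , _ ← dt a a′ b b′ d e = g , g∈G , ga≡b

module _ {Γ₁ Γ₂ : Digraph} where

  horiz⁻¹ : ∀ {a b x y} → SD Γ₁ Γ₂ (a , x , false) (b , y , true) → D Γ₁ a b × x ≡ y
  horiz⁻¹ (horiz _ d) = d , refl

  horiz-≡ : ∀ {a b x y} → D Γ₁ a b → x ≡ y → SD Γ₁ Γ₂ (a , x , false) (b , y , true)
  horiz-≡ d refl = horiz _ d

  vert⁻¹ : ∀ {a b x y} → SD Γ₁ Γ₂ (a , x , true) (b , y , false) → a ≡ b × D Γ₂ x y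
  vert⁻¹ (vert _ d) = refl , d

  vert-≡ : ∀ {a b x y} → a ≡ b → D Γ₂ x y → SD Γ₁ Γ₂ (a , x , true) (b , y , false)
  vert-≡ refl d = vert _ d

  monochromatic-dart : ∀ {a b x y i} → ¬ SD Γ₁ Γ₂ (a , x , i) (b , y , i)
  monochromatic-dart ()

  white-tail⇒Horizontal : ∀ {u v} → SD Γ₁ Γ₂ u v → White Γ₁ Γ₂ u → Horizontal Γ₁ Γ₂ u v
  white-tail⇒Horizontal (horiz x d) refl = _ , _ , x , d , refl , refl

  black-tail⇒Vertical : ∀ {u v} → SD Γ₁ Γ₂ u v → Black Γ₁ Γ₂ u → Vertical Γ₁ Γ₂ u v
  black-tail⇒Vertical (vert a d) refl = a , _ , _ , d , refl , refl

SBP-iso : ∀ {Γ₁ Γ₂ Δ₁ Δ₂} (σ₁ : V Γ₁ ↔ V Δ₁) (σ₂ : V Γ₂ ↔ V Δ₂) →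
  IsIso Γ₁ Δ₁ σ₁ → IsIso Γ₂ Δ₂ σ₂ →
  IsIso (SBP Γ₁ Γ₂) (SBP Δ₁ Δ₂) (σ₁ ×-↔ (σ₂ ×-↔ ↔-id Bool))
SBP-iso {Γ₁} {Γ₂} {Δ₁} {Δ₂} σ₁ σ₂ iso₁ iso₂ u v = preserve , reflect u v
  where
  σ : SV Γ₁ Γ₂ → SV Δ₁ Δ₂
  σ = Inverse.to (σ₁ ×-↔ (σ₂ ×-↔ ↔-id Bool))

  preserve : ∀ {u v} → SD Γ₁ Γ₂ u v → SD Δ₁ Δ₂ (σ u) (σ v)
  preserve (horiz x d) = horiz _ (proj₁ (iso₁ _ _) d)
  preserve (vert a d) = vert _ (proj₁ (iso₂ _ _) d)

  reflect : ∀ u v → SD Δ₁ Δ₂ (σ u) (σ v) → SD Γ₁ Γ₂ u v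
  reflect (a , x , false) (b , y , true) s =
    let d , σx≡σy = horiz⁻¹ s in horiz-≡ (proj₂ (iso₁ a b) d) (to-injective σ₂ σx≡σy)
  reflect (a , x , true) (b , y , false) s =
    let σa≡σb , d = vert⁻¹ s in vert-≡ (to-injective σ₁ σa≡σb) (proj₂ (iso₂ x y) d)
  reflect (_ , _ , false) (_ , _ , false) s = ⊥-elim (monochromatic-dart s)
  reflect (_ , _ , true) (_ , _ , true) s = ⊥-elim (monochromatic-dart s)

SBP-Rev-iso : ∀ {Γ₁ Γ₂} → IsIso (SBP (Rev Γ₁) (Rev Γ₂)) (Rev (SBP Γ₁ Γ₂))
  (↔-id (V Γ₁) ×-↔ (↔-id (V Γ₂) ×-↔ notPerm Γ₁ Γ₂))
SBP-Rev-iso {Γ₁} {Γ₂} u v = preserve , reflect u v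
  where
  flip-colour : SV Γ₁ Γ₂ → SV Γ₁ Γ₂
  flip-colour = Inverse.to (↔-id (V Γ₁) ×-↔ (↔-id (V Γ₂) ×-↔ notPerm Γ₁ Γ₂))

  preserve : ∀ {u v} → SD (Rev Γ₁) (Rev Γ₂) u v → SD Γ₁ Γ₂ (flip-colour v) (flip-colour u)
  preserve (horiz x d) = horiz x d
  preserve (vert a d) = vert a d

  reflect : ∀ u v → SD Γ₁ Γ₂ (flip-colour v) (flip-colour u) → SD (Rev Γ₁) (Rev Γ₂) u v
  reflect (a , x , false) (b , .x , true) (horiz .x d) = horiz x d
  reflect (a , x , true) (.a , y , false) (vert .a d) = vert a d

SBP-reversal : ∀ {Γ₁ Γ₂} (σ₁ : Perm (V Γ₁)) (σ₂ : Perm (V Γ₂)) →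
  IsReversal Γ₁ σ₁ → IsReversal Γ₂ σ₂ → IsReversal (SBP Γ₁ Γ₂) (revPerm Γ₁ Γ₂ σ₁ σ₂)
SBP-reversal {Γ₁} {Γ₂} σ₁ σ₂ rev₁ rev₂ =
  IsIso-∘ {Δ = SBP (Rev Γ₁) (Rev Γ₂)} {Θ = Rev (SBP Γ₁ Γ₂)}
    {σ = σ₁ ×-↔ (σ₂ ×-↔ ↔-id Bool)} {τ = ↔-id (V Γ₁) ×-↔ (↔-id (V Γ₂) ×-↔ notPerm Γ₁ Γ₂)}
    (SBP-iso σ₁ σ₂ rev₁ rev₂) SBP-Rev-iso

module _ {Γ₁ Γ₂ : Digraph} where

  SameColour : SV Γ₁ Γ₂ → SV Γ₁ Γ₂ → Set
  SameColour u v = (White Γ₁ Γ₂ u × White Γ₁ Γ₂ v) ⊎ (Black Γ₁ Γ₂ u × Black Γ₁ Γ₂ v)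

  SameDartKind : (u v u′ v′ : SV Γ₁ Γ₂) → Set
  SameDartKind u v u′ v′ =
    (Horizontal Γ₁ Γ₂ u v × Horizontal Γ₁ Γ₂ u′ v′) ⊎ (Vertical Γ₁ Γ₂ u v × Vertical Γ₁ Γ₂ u′ v′)

  SameColour⇒≡ : ∀ u v → SameColour u v → proj₂ (proj₂ u) ≡ proj₂ (proj₂ v)
  SameColour⇒≡ _ _ (inj₁ (refl , refl)) = refl
  SameColour⇒≡ _ _ (inj₂ (refl , refl)) = refl

  SameColour-act : ∀ g₁ g₂ u → SameColour u (act Γ₁ Γ₂ g₁ g₂ u)
  SameColour-act g₁ g₂ (a , x , false) = inj₁ (refl , refl)
  SameColour-act g₁ g₂ (a , x , true) = inj₂ (refl , refl)

  module _ (G₁ : Subgroup≤Aut Γ₁) (G₂ : Subgroup≤Aut Γ₂) where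

    SameVertexOrbit : SV Γ₁ Γ₂ → SV Γ₁ Γ₂ → Set
    SameVertexOrbit u v = ∃ λ g₁ → ∃ λ g₂ → _∈G G₁ g₁ × _∈G G₂ g₂ × act Γ₁ Γ₂ g₁ g₂ u ≡ v

    SameDartOrbit : (u v u′ v′ : SV Γ₁ Γ₂) → Set
    SameDartOrbit u v u′ v′ = ∃ λ g₁ → ∃ λ g₂ → _∈G G₁ g₁ × _∈G G₂ g₂ ×
      act Γ₁ Γ₂ g₁ g₂ u ≡ u′ × act Γ₁ Γ₂ g₁ g₂ v ≡ v′

    SameVertexOrbit⇒SameColour : ∀ {u v} → SameVertexOrbit u v → SameColour u v
    SameVertexOrbit⇒SameColour {u} (g₁ , g₂ , _ , _ , refl) = SameColour-act g₁ g₂ u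

    SameColour⇒SameVertexOrbit : VertexTransitive Γ₁ G₁ → VertexTransitive Γ₂ G₂ →
      ∀ {u v} → SameColour u v → SameVertexOrbit u v
    SameColour⇒SameVertexOrbit vt₁ vt₂ {a , x , i} {b , y , j} same
      with g₁ , g₁∈G₁ , refl ← vt₁ a b | g₂ , g₂∈G₂ , refl ← vt₂ x y
         | refl ← SameColour⇒≡ (a , x , i) (b , y , j) same
      = g₁ , g₂ , g₁∈G₁ , g₂∈G₂ , refl

    SameDartOrbit⇒SameDartKind : ∀ {u v u′ v′} → SD Γ₁ Γ₂ u v → SD Γ₁ Γ₂ u′ v′ →
      SameDartOrbit u v u′ v′ → SameDartKind u v u′ v′
    SameDartOrbit⇒SameDartKind {u} s s′ (g₁ , g₂ , _ , _ , refl , _)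
      with SameColour-act g₁ g₂ u
    ... | inj₁ (white , white′) =
      inj₁ (white-tail⇒Horizontal s white , white-tail⇒Horizontal s′ white′)
    ... | inj₂ (black , black′) =
      inj₂ (black-tail⇒Vertical s black , black-tail⇒Vertical s′ black′)

    SameDartKind⇒SameDartOrbit : NoSinks Γ₁ → NoSinks Γ₂ →
      DartTransitive Γ₁ G₁ → DartTransitive Γ₂ G₂ →
      ∀ {u v u′ v′} → SameDartKind u v u′ v′ → SameDartOrbit u v u′ v′
    SameDartKind⇒SameDartOrbit _ no-sinks₂ dt₁ dt₂
      (inj₁ ((a , b , x , d , refl , refl) , (a′ , b′ , x′ , d′ , refl , refl)))
      with g₁ , g₁∈G₁ , refl , refl ← dt₁ a b a′ b′ d d′
         | g₂ , g₂∈G₂ , refl ← DartTransitive⇒VertexTransitive G₂ no-sinks₂ dt₂ x x′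
      = g₁ , g₂ , g₁∈G₁ , g₂∈G₂ , refl , refl
    SameDartKind⇒SameDartOrbit no-sinks₁ _ dt₁ dt₂
      (inj₂ ((a , x , y , d , refl , refl) , (a′ , x′ , y′ , d′ , refl , refl)))
      with g₂ , g₂∈G₂ , refl , refl ← dt₂ x y x′ y′ d d′
         | g₁ , g₁∈G₁ , refl ← DartTransitive⇒VertexTransitive G₁ no-sinks₁ dt₁ a a′
      = g₁ , g₂ , g₁∈G₁ , g₂∈G₂ , refl , refl

act-faithful : ∀ {Γ₁ Γ₂} → V Γ₁ → V Γ₂ → (g₁ : Perm (V Γ₁)) (g₂ : Perm (V Γ₂)) →
  (∀ v → act Γ₁ Γ₂ g₁ g₂ v ≡ v) → (∀ a → Inverse.to g₁ a ≡ a) × (∀ x → Inverse.to g₂ x ≡ x)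
act-faithful a₀ x₀ _ _ fixes =
  (λ a → cong proj₁ (fixes (a , x₀ , false))) ,
  (λ x → cong (λ v → proj₁ (proj₂ v)) (fixes (a₀ , x , false)))

lemma3p1 : (Γ₁ Γ₂ : Digraph) →
    IsDigraph Γ₁ → IsDigraph Γ₂ →
    NoSources Γ₁ → NoSinks Γ₁ → NoSources Γ₂ → NoSinks Γ₂ →
    (G₁ : Subgroup≤Aut Γ₁) (G₂ : Subgroup≤Aut Γ₂) →
    -- each (g₁,g₂) acts as a symmetry of SBP(Γ₁,Γ₂)
    ((g₁ : _) (g₂ : _) → _∈G G₁ g₁ → _∈G G₂ g₂ →
      IsSymmetry (SBP Γ₁ Γ₂) (actPerm Γ₁ Γ₂ g₁ g₂))
    -- it is an action: identity acts trivially, compatible with products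
    × (∀ v → act Γ₁ Γ₂ (↔-id _) (↔-id _) v ≡ v)
    × ((g₁ h₁ : _) (g₂ h₂ : _) → _∈G G₁ g₁ → _∈G G₁ h₁ → _∈G G₂ g₂ → _∈G G₂ h₂ →
      ∀ v → act Γ₁ Γ₂ (h₁ ↔-∘ g₁) (h₂ ↔-∘ g₂) v ≡ act Γ₁ Γ₂ h₁ h₂ (act Γ₁ Γ₂ g₁ g₂ v))
    -- faithful
    × ((g₁ : _) (g₂ : _) → _∈G G₁ g₁ → _∈G G₂ g₂ →
      (∀ v → act Γ₁ Γ₂ g₁ g₂ v ≡ v) →
      (∀ a → Inverse.to g₁ a ≡ a) × (∀ x → Inverse.to g₂ x ≡ x))
    -- (i) vertex orbits are exactly the white and the black vertices
    × (VertexTransitive Γ₁ G₁ → VertexTransitive Γ₂ G₂ →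
      ∀ u v →
        ((∃ λ g₁ → ∃ λ g₂ → _∈G G₁ g₁ × _∈G G₂ g₂ × act Γ₁ Γ₂ g₁ g₂ u ≡ v)
          → ((White Γ₁ Γ₂ u × White Γ₁ Γ₂ v) ⊎ (Black Γ₁ Γ₂ u × Black Γ₁ Γ₂ v)))
        × (((White Γ₁ Γ₂ u × White Γ₁ Γ₂ v) ⊎ (Black Γ₁ Γ₂ u × Black Γ₁ Γ₂ v))
          → (∃ λ g₁ → ∃ λ g₂ → _∈G G₁ g₁ × _∈G G₂ g₂ × act Γ₁ Γ₂ g₁ g₂ u ≡ v)))
    -- (ii) dart orbits are exactly the horizontal and the vertical darts
    × (DartTransitive Γ₁ G₁ → DartTransitive Γ₂ G₂ →
      ∀ u v u′ v′ → SD Γ₁ Γ₂ u v → SD Γ₁ Γ₂ u′ v′ →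
        ((∃ λ g₁ → ∃ λ g₂ → _∈G G₁ g₁ × _∈G G₂ g₂ ×
            act Γ₁ Γ₂ g₁ g₂ u ≡ u′ × act Γ₁ Γ₂ g₁ g₂ v ≡ v′)
          → ((Horizontal Γ₁ Γ₂ u v × Horizontal Γ₁ Γ₂ u′ v′)
             ⊎ (Vertical Γ₁ Γ₂ u v × Vertical Γ₁ Γ₂ u′ v′)))
        × (((Horizontal Γ₁ Γ₂ u v × Horizontal Γ₁ Γ₂ u′ v′)
             ⊎ (Vertical Γ₁ Γ₂ u v × Vertical Γ₁ Γ₂ u′ v′))
          → (∃ λ g₁ → ∃ λ g₂ → _∈G G₁ g₁ × _∈G G₂ g₂ ×
            act Γ₁ Γ₂ g₁ g₂ u ≡ u′ × act Γ₁ Γ₂ g₁ g₂ v ≡ v′)))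
    -- reversals
    × ((σ₁ : _) (σ₂ : _) → IsReversal Γ₁ σ₁ → IsReversal Γ₂ σ₂ →
      IsReversal (SBP Γ₁ Γ₂) (revPerm Γ₁ Γ₂ σ₁ σ₂))
lemma3p1 Γ₁ Γ₂ (_ , a₀ , _) (_ , x₀ , _) _ no-sinks₁ _ no-sinks₂ G₁ G₂ =
  (λ g₁ g₂ g₁∈G₁ g₂∈G₂ → SBP-iso g₁ g₂ (sym-G G₁ g₁ g₁∈G₁) (sym-G G₂ g₂ g₂∈G₂)) ,
  (λ _ → refl) ,
  (λ _ _ _ _ _ _ _ _ _ → refl) ,
  (λ g₁ g₂ _ _ → act-faithful {Γ₁} {Γ₂} a₀ x₀ g₁ g₂) ,
  (λ vt₁ vt₂ _ _ →
    SameVertexOrbit⇒SameColour G₁ G₂ , SameColour⇒SameVertexOrbit G₁ G₂ vt₁ vt₂) ,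
  (λ dt₁ dt₂ _ _ _ _ s s′ →
    SameDartOrbit⇒SameDartKind G₁ G₂ s s′ ,
    SameDartKind⇒SameDartOrbit G₁ G₂ no-sinks₁ no-sinks₂ dt₁ dt₂) ,
  SBP-reversal
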